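{- For each natural number $n$, there are only finitely many positive CS $n$-sets.
   Context: A CS-set is a finite multiset $\langle a_1,\dots,a_n\rangle$ of integers (repeated elements allowed, order irrelevant) such that $a_1^3+a_2^3+\cdots+a_n^3=(a_1+a_2+\cdots+a_n)^2$, where it is required that no $a_i$ equals $0$ and that the multiset does not contain both $k$ and $-k$ for any integer $k$. A CS $n$-set is a CS-set with exactly $n$ elements (counted with multiplicity). A positive CS-set is one all of whose entries are positive integers. -}

module Defs where

open import Data.Integer using (ℤ; _+_; _*_; -_; +_; 0ℤ; _>_)
open import Data.List using (List; []; _∷_; map; length)
open import Data.List.Relation.Unary.All using (All)
open import Data.List.Membership.Propositional using (_∈_; _∉_)
open import Data.List.Relation.Binary.Permutation.Propositional using (_↭_)
open import Data.List.Relation.Unary.Any using (Any)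
open import Data.Product using (_×_; Σ)
open import Data.Nat using (ℕ)
open import Relation.Binary.PropositionalEquality using (_≡_; _≢_)
open import Relation.Nullary using (¬_)

-- A finite multiset of integers is represented by a list, considered up to
-- permutation (_↭_).

sumℤ : List ℤ → ℤ
sumℤ [] = 0ℤ
sumℤ (x ∷ xs) = x + sumℤ xs

cube : ℤ → ℤ
cube a = a * a * a

record IsCS (xs : List ℤ) : Set where
  field
    cubeSum   : sumℤ (map cube xs) ≡ sumℤ xs * sumℤ xs
    nonzero   : All (λ a → a ≢ 0ℤ) xs
    noOpposite : ∀ (k : ℤ) → ¬ (k ∈ xs × (- k) ∈ xs)

IsCSn : ℕ → List ℤ → Set
IsCSn n xs = IsCS xs × length xs ≡ n

IsPositive : List ℤ → Set
IsPositive xs = All (λ a → a > 0ℤ) xs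

FinitelyManyMultisets : (List ℤ → Set) → Set
FinitelyManyMultisets P =
  Σ (List (List ℤ)) λ L → ∀ xs → P xs → Any (λ ys → xs ↭ ys) L

{-# OPTIONS --safe #-}
-- If M is the largest entry and S the sum of a positive CS n-set, then
-- M³ ≤ Σ a³ = S² ≤ (n M)², so M ≤ n².  Hence every positive CS n-set is a
-- list of length n with entries in {1, …, n²}, and there are finitely many.
module Submission where

open import Defs
open import Data.Nat using (ℕ)
open import Data.List using (List)
open import Data.Integer using (ℤ)
open import Data.Product using (_×_)

open import Data.Nat as ℕ using (zero; suc; _≤_; z≤n; s≤s)
open import Data.Nat.Properties
open import Data.Nat.ListAction using (sum)
open import Data.Nat.Solver using (module +-*-Solver)
open import Data.Integer as ℤ using (+_; ∣_∣; +<+)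
import Data.Integer.Properties as ℤ
open import Data.List using ([]; _∷_; [_]; map; length; upTo; cartesianProductWith)
open import Data.List.Properties using (length-map; map-∘; map-cong)
open import Data.List.Extrema.Nat using (max; xs≤max; argmax-sel)
open import Data.List.Relation.Unary.All as All using (All; []; _∷_)
import Data.List.Relation.Unary.All.Properties as All
open import Data.List.Relation.Unary.Any as Any using (here; there)
open import Data.List.Membership.Propositional using (_∈_)
open import Data.List.Membership.Propositional.Properties
  using (∈-map⁺; ∈-upTo⁺; ∈-cartesianProductWith⁺)
open import Data.List.Relation.Binary.Permutation.Propositional using (↭-reflexive)
open import Data.Product using (_,_)
open import Data.Sum using (inj₁; inj₂)
open import Function using (_∘_)
open import Relation.Binary.PropositionalEquality hiding ([_])

private
  variable
    A : Set

cubeℕ : ℕ → ℕ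
cubeℕ m = m ℕ.* m ℕ.* m

∈⇒≤sum : ∀ {m ns} → m ∈ ns → m ≤ sum ns
∈⇒≤sum {ns = n ∷ ns} (here refl) = m≤m+n n (sum ns)
∈⇒≤sum {ns = n ∷ ns} (there p)   = ≤-trans (∈⇒≤sum p) (m≤n+m (sum ns) n)

sum≤length*bound : ∀ {b} ns → All (_≤ b) ns → sum ns ≤ length ns ℕ.* b
sum≤length*bound []       []         = z≤n
sum≤length*bound (n ∷ ns) (n≤b ∷ ps) = +-mono-≤ n≤b (sum≤length*bound ns ps)

cube≤square[n*m]⇒≤n² : ∀ n m → cubeℕ m ≤ (n ℕ.* m) ℕ.* (n ℕ.* m) → m ≤ n ℕ.* n
cube≤square[n*m]⇒≤n² n zero      _  = z≤n
cube≤square[n*m]⇒≤n² n m@(suc _) le =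
  *-cancelʳ-≤ m (n ℕ.* n) (m ℕ.* m) (subst₂ _≤_ m³ [nm]² le)
  where
  open +-*-Solver
  m³ : cubeℕ m ≡ m ℕ.* (m ℕ.* m)
  m³ = solve 1 (λ m → m :* m :* m := m :* (m :* m)) refl m
  [nm]² : (n ℕ.* m) ℕ.* (n ℕ.* m) ≡ (n ℕ.* n) ℕ.* (m ℕ.* m)
  [nm]² = solve 2 (λ n m → (n :* m) :* (n :* m) := (n :* n) :* (m :* m)) refl n m

sum-cubes≡square-sum⇒≤length² :
  ∀ ms → sum (map cubeℕ ms) ≡ sum ms ℕ.* sum ms →
  All (_≤ length ms ℕ.* length ms) ms
sum-cubes≡square-sum⇒≤length² ms eq =
  All.map (λ m≤M → ≤-trans m≤M max≤length²) (xs≤max 0 ms)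
  where
  n = length ms
  M = max 0 ms
  max≤length² : M ≤ n ℕ.* n
  max≤length² with argmax-sel (λ m → m) 0 ms
  ... | inj₁ M≡0 = subst (_≤ n ℕ.* n) (sym M≡0) z≤n
  ... | inj₂ M∈ms = cube≤square[n*m]⇒≤n² n M (begin
    cubeℕ M                     ≤⟨ ∈⇒≤sum (∈-map⁺ cubeℕ M∈ms) ⟩
    sum (map cubeℕ ms)          ≡⟨ eq ⟩
    sum ms ℕ.* sum ms           ≤⟨ *-mono-≤ S≤nM S≤nM ⟩
    (n ℕ.* M) ℕ.* (n ℕ.* M)     ∎)
    where
    open ≤-Reasoning
    S≤nM : sum ms ≤ n ℕ.* M
    S≤nM = sum≤length*bound ms (xs≤max 0 ms)

tuples : List A → ℕ → List (List A)
tuples xs zero    = [ [] ]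
tuples xs (suc n) = cartesianProductWith _∷_ xs (tuples xs n)

∈-tuples⁺ : ∀ {xs : List A} ys → All (_∈ xs) ys → ys ∈ tuples xs (length ys)
∈-tuples⁺ []       []         = here refl
∈-tuples⁺ (y ∷ ys) (y∈ ∷ ys∈) = ∈-cartesianProductWith⁺ _∷_ y∈ (∈-tuples⁺ ys ys∈)

positive⇒map-+ : ∀ {xs} → IsPositive xs → xs ≡ map +_ (map ∣_∣ xs)
positive⇒map-+ []          = refl
positive⇒map-+ (+<+ _ ∷ ps) = cong (_ ∷_) (positive⇒map-+ ps)

sumℤ-map-+ : ∀ ms → sumℤ (map +_ ms) ≡ + sum ms
sumℤ-map-+ []       = refl
sumℤ-map-+ (m ∷ ms) = trans (cong (ℤ._+_ (+ m)) (sumℤ-map-+ ms)) (sym (ℤ.pos-+ m (sum ms)))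

cube-+ : ∀ m → cube (+ m) ≡ + cubeℕ m
cube-+ m = sym (trans (ℤ.pos-* (m ℕ.* m) m) (cong (ℤ._* + m) (ℤ.pos-* m m)))

IsCS-map-+⇒sum-cubes≡square-sum :
  ∀ ms → IsCS (map +_ ms) → sum (map cubeℕ ms) ≡ sum ms ℕ.* sum ms
IsCS-map-+⇒sum-cubes≡square-sum ms cs = ℤ.+-injective (begin
  + sum (map cubeℕ ms)                  ≡⟨ sumℤ-map-+ (map cubeℕ ms) ⟨
  sumℤ (map +_ (map cubeℕ ms))          ≡⟨ cong sumℤ (sym cubes) ⟩
  sumℤ (map cube (map +_ ms))           ≡⟨ IsCS.cubeSum cs ⟩
  sumℤ (map +_ ms) ℤ.* sumℤ (map +_ ms) ≡⟨ cong₂ ℤ._*_ (sumℤ-map-+ ms) (sumℤ-map-+ ms) ⟩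
  + sum ms ℤ.* + sum ms                 ≡⟨ ℤ.pos-* (sum ms) (sum ms) ⟨
  + (sum ms ℕ.* sum ms)                 ∎)
  where
  open ≡-Reasoning
  cubes : map cube (map +_ ms) ≡ map +_ (map cubeℕ ms)
  cubes = trans (sym (map-∘ ms)) (trans (map-cong cube-+ ms) (map-∘ ms))

proposition2 : (n : ℕ) → FinitelyManyMultisets (λ xs → IsCSn n xs × IsPositive xs)
proposition2 n = tuples range n , λ xs → Any.map ↭-reflexive ∘ ∈-candidates xs
  where
  range : List ℤ
  range = map +_ (upTo (suc (n ℕ.* n)))

  ∈-candidates : ∀ xs → IsCSn n xs × IsPositive xs → xs ∈ tuples range n
  ∈-candidates xs ((cs , refl) , pos) =
    subst (λ xs → xs ∈ tuples range (length xs)) (sym xs≡) (∈-tuples⁺ (map +_ ms) entries∈)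
    where
    ms : List ℕ
    ms = map ∣_∣ xs
    xs≡ : xs ≡ map +_ ms
    xs≡ = positive⇒map-+ pos
    bounded : All (_≤ length xs ℕ.* length xs) ms
    bounded = subst (λ l → All (_≤ l ℕ.* l) ms) (length-map ∣_∣ xs)
      (sum-cubes≡square-sum⇒≤length² ms
        (IsCS-map-+⇒sum-cubes≡square-sum ms (subst IsCS xs≡ cs)))
    entries∈ : All (_∈ range) (map +_ ms)
    entries∈ = All.map⁺ (All.map (∈-map⁺ +_ ∘ ∈-upTo⁺ ∘ s≤s) bounded)
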